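{- Let $r,m$ be integers with $0<r<m$ and $\gcd(r,m)=1$, and let $\frac rm=[0;a_1,a_2,\dots,a_n]$ be a simple continued fraction expansion of $r/m$ (either one of its two expansions), with convergents $p_k/q_k$. Then \[H(\tfrac rm)=\min_{0\le k<n/2}\Big\{\,q_{2k}\,\frac{r+1}{m}-p_{2k}\Big\}.\]
   Context: For relatively prime positive integers $r,m$, $H(r/m)=\min\{k/m+\{kr/m\}:1\le k<m\}$, where $\{x\}=x-\lfloor x\rfloor$. For $[0;a_1,\dots,a_n]$ with $a_0=0$ and positive integers $a_1,\dots,a_n$, the convergents $p_k/q_k=[a_0;a_1,\dots,a_k]$ are given by $p_{ -2}=0,p_{ -1}=1$, $q_{ -2}=1,q_{ -1}=0$, and $p_k=a_kp_{k-1}+p_{k-2}$, $q_k=a_kq_{k-1}+q_{k-2}$ for $k\ge 0$; in particular $p_0/q_0=0/1$. -}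

module Defs where

open import Data.Nat as ℕ using (ℕ; zero; suc; _<ᵇ_)
open import Data.Integer as ℤ using (ℤ; +_)
open import Data.Rational using (ℚ; 0ℚ; _/_; _+_; _-_; _*_; _⊓_; floor)
open import Data.List using (List; []; _∷_; foldr; map; upTo; filter)
open import Data.Bool using (T)
open import Relation.Nullary.Decidable using (T?)

-- the rational number a / b for natural a, b (b is nonzero in every use below;
-- the value 0 for b = 0 is an irrelevant convention)
_÷_ : ℕ → ℕ → ℚ
a ÷ zero = 0ℚ
a ÷ suc b = (+ a) / suc b

⟦_⟧ : ℕ → ℚ
⟦ a ⟧ = a ÷ 1

fract : ℚ → ℚ
fract x = x - ((floor x) / 1)

-- minimum of f over a list of indices (the lists used below are nonempty)
minOver : (ℕ → ℚ) → List ℕ → ℚ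
minOver f [] = 0ℚ
minOver f (x ∷ xs) = foldr (λ y acc → f y ⊓ acc) (f x) xs

H : ℕ → ℕ → ℚ
H r m = minOver (λ k → (k ÷ m) + fract ((k ℕ.* r) ÷ m)) (map suc (upTo (m ℕ.∸ 1)))

-- Convergents of [a 0; a 1, ..., a n] (a : ℕ → ℕ lists the partial quotients).
-- pp a (k + 2) = p_k, with pp a 0 = p_{-2} = 0, pp a 1 = p_{-1} = 1.
pp : (ℕ → ℕ) → ℕ → ℕ
pp a zero = 0
pp a (suc zero) = 1
pp a (suc (suc k)) = a k ℕ.* pp a (suc k) ℕ.+ pp a k

-- qq a (k + 2) = q_k, with qq a 0 = q_{-2} = 1, qq a 1 = q_{-1} = 0.
qq : (ℕ → ℕ) → ℕ → ℕ
qq a zero = 1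
qq a (suc zero) = 0
qq a (suc (suc k)) = a k ℕ.* qq a (suc k) ℕ.+ qq a k

p : (ℕ → ℕ) → ℕ → ℕ
p a k = pp a (suc (suc k))

q : (ℕ → ℕ) → ℕ → ℕ
q a k = qq a (suc (suc k))

cfValue : (ℕ → ℕ) → ℕ → ℚ
cfValue a n = p a n ÷ q a n

evenRange : ℕ → List ℕ
evenRange n = filter (λ k → T? ((2 ℕ.* k) <ᵇ n)) (upTo n)

-- For 1 ≤ k < m the term k/m + {k r/m} of H equals L(k, ⌊k r/m⌋) / m for the linear form
-- L(x, y) = x (r + 1) - y m.  The errors (-1)^j (q_j r - p_j m) are nonnegative, so
-- p_{2i} ≤ ⌊q_{2i} r/m⌋ and k = q_{2i} has H-term at most L(q_{2i}, p_{2i}) / m.  Conversely, the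
-- coordinates of (k, ⌊k r/m⌋) in the bases formed by consecutive convergents change sign between
-- two consecutive even indices (or at the last convergent); there L(k, ⌊k r/m⌋) is a combination
-- of the L-values of the adjacent even convergents with total weight at least 1, hence at least
-- the smaller of them.

{-# OPTIONS --safe #-}
module Submission where

open import Defs
open import Data.Nat using (ℕ; _<_; _≤_; _*_; _+_)
open import Data.Nat.GCD using (gcd)
open import Data.Rational using (_-_) renaming (_*_ to _*ℚ_)
open import Relation.Binary.PropositionalEquality using (_≡_)

open import Data.Empty using (⊥; ⊥-elim)
open import Data.Integer as ℤ using (ℤ; +_; 0ℤ; 1ℤ; -1ℤ; +≤+)
import Data.Integer.Properties as ℤP
open import Data.Integer.Tactic.RingSolver using (solve-∀)
open import Data.List using ([]; _∷_; map; upTo)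
open import Data.List.Membership.Propositional using (_∈_)
open import Data.List.Membership.Propositional.Properties
  using (∈-map⁺; ∈-map⁻; ∈-upTo⁺; ∈-upTo⁻; ∈-filter⁺; ∈-filter⁻)
open import Data.List.Relation.Unary.Any using (here; there)
open import Data.Nat as ℕ using (zero; suc; z≤n; s≤s; NonZero)
open import Data.Nat.Coprimality using (Coprime; gcd≡1⇒coprime; coprime-divisor)
import Data.Nat.Coprimality as Coprime
open import Data.Nat.DivMod using (_/_; _%_; m≡m%n+[m/n]*n; m*n/n≡m; m*n/o*n≡m/o; /-monoˡ-≤; /-congˡ; /-congʳ)
open import Data.Nat.Divisibility using (_∣_; divides; n∣m*n; ∣1⇒≡1; ∣⇒≤; m%n≡0⇒n∣m)
import Data.Nat.Properties as ℕP
open import Data.Product using (∃; _×_; _,_; proj₁; proj₂)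
open import Data.Rational as ℚ using (ℚ; mkℚ; floor; toℚᵘ)
import Data.Rational.Properties as ℚP
open import Data.Rational.Unnormalised as ℚᵘ using (mkℚᵘ; *≡*; *≤*; _≃_)
import Data.Rational.Unnormalised.Properties as ℚᵘP
open import Data.Sum using (_⊎_; inj₁; inj₂)
import Data.Sum as Sum
open import Function using (_∘_)
open import Relation.Binary.PropositionalEquality
  using (refl; sym; trans; cong; cong₂; subst; subst₂; module ≡-Reasoning)
open import Relation.Nullary using (yes; no)
import Relation.Nullary.Decidable as Dec

*-nonNeg : ∀ {i j} → 0ℤ ℤ.≤ i → 0ℤ ℤ.≤ j → 0ℤ ℤ.≤ i ℤ.* j
*-nonNeg {+ i} {+ j} _ _ = subst (0ℤ ℤ.≤_) (ℤP.pos-* i j) (+≤+ z≤n)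

≤-by-scaled-difference : ∀ {c x y} z → 1ℤ ℤ.≤ c → c ℤ.* (y ℤ.- x) ≡ z → 0ℤ ℤ.≤ z → x ℤ.≤ y
≤-by-scaled-difference {c} {x} {y} z 1≤c eq 0≤z = ℤP.0≤i-j⇒j≤i
  (ℤP.*-cancelˡ-≤-pos 0ℤ (y ℤ.- x) c {{ℤ.positive (ℤP.suc[i]≤j⇒i<j 1≤c)}}
    (subst₂ ℤ._≤_ (sym (ℤP.*-zeroʳ c)) (sym eq) 0≤z))

≤-by-difference : ∀ {x y} z → y ℤ.- x ≡ z → 0ℤ ℤ.≤ z → x ℤ.≤ y
≤-by-difference {x} {y} z eq = ≤-by-scaled-difference z ℤP.≤-refl (trans (ℤP.*-identityˡ (y ℤ.- x)) eq)

≤-cross-difference : ∀ {D₀ D₁ L₀ L₁} → D₀ ℤ.≤ 0ℤ → 1ℤ ℤ.≤ D₁ → 0ℤ ℤ.≤ L₀ → 0ℤ ℤ.≤ L₁ →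
                     L₀ ℤ.≤ L₀ ℤ.* D₁ ℤ.- L₁ ℤ.* D₀
≤-cross-difference {D₀} {D₁} {L₀} {L₁} D₀≤0 1≤D₁ 0≤L₀ 0≤L₁ =
  ≤-by-difference _ (identity D₀ D₁ L₀ L₁)
    (ℤP.+-mono-≤ (*-nonNeg 0≤L₀ (ℤP.i≤j⇒0≤j-i 1≤D₁)) (*-nonNeg 0≤L₁ (ℤP.neg-mono-≤ D₀≤0)))
  where
  identity : ∀ D₀ D₁ L₀ L₁ → L₀ ℤ.* D₁ ℤ.- L₁ ℤ.* D₀ ℤ.- L₀ ≡ L₀ ℤ.* (D₁ ℤ.- 1ℤ) ℤ.+ L₁ ℤ.* ℤ.- D₀
  identity = solve-∀

-- For X = L₀ D₁ - L₁ D₀ and L₂ = c L₁ + L₀: with S = c D₁ + D₀ ≥ 1 and T = - D₀ ≥ 0 one has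
-- c X = S L₀ + T L₂ and S + T = c D₁ ≥ c, so X is at least the smaller of L₀ and L₂.
min-≤-cross-difference : ∀ {c D₀ D₁ L₀ L₁} → 1ℤ ℤ.≤ c → D₀ ℤ.≤ 0ℤ → 1ℤ ℤ.≤ c ℤ.* D₁ ℤ.+ D₀ →
  0ℤ ℤ.≤ L₀ → 0ℤ ℤ.≤ c ℤ.* L₁ ℤ.+ L₀ →
  L₀ ℤ.≤ L₀ ℤ.* D₁ ℤ.- L₁ ℤ.* D₀ ⊎ c ℤ.* L₁ ℤ.+ L₀ ℤ.≤ L₀ ℤ.* D₁ ℤ.- L₁ ℤ.* D₀
min-≤-cross-difference {c} {D₀} {D₁} {L₀} {L₁} 1≤c D₀≤0 1≤S 0≤L₀ 0≤L₂ =
  Sum.map below-L₀ below-L₂ (ℤP.≤-total L₀ (c ℤ.* L₁ ℤ.+ L₀))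
  where
  0≤c : 0ℤ ℤ.≤ c
  0≤c = ℤP.≤-trans (+≤+ z≤n) 1≤c
  0<cD₁ : 0ℤ ℤ.< c ℤ.* D₁
  0<cD₁ = ℤP.suc[i]≤j⇒i<j (ℤP.≤-trans 1≤S
            (subst (c ℤ.* D₁ ℤ.+ D₀ ℤ.≤_) (ℤP.+-identityʳ (c ℤ.* D₁)) (ℤP.+-monoʳ-≤ (c ℤ.* D₁) D₀≤0)))
  1≤D₁ : 1ℤ ℤ.≤ D₁
  1≤D₁ = ℤP.i<j⇒suc[i]≤j (ℤP.*-cancelˡ-<-nonNeg c {{ℤ.nonNegative 0≤c}}
           (subst (ℤ._< c ℤ.* D₁) (sym (ℤP.*-zeroʳ c)) 0<cD₁))
  0≤c[D₁-1] : 0ℤ ℤ.≤ c ℤ.* (D₁ ℤ.- 1ℤ)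
  0≤c[D₁-1] = *-nonNeg 0≤c (ℤP.i≤j⇒0≤j-i 1≤D₁)
  identity₀ : ∀ c D₀ D₁ L₀ L₁ → c ℤ.* (L₀ ℤ.* D₁ ℤ.- L₁ ℤ.* D₀ ℤ.- L₀)
                              ≡ c ℤ.* (D₁ ℤ.- 1ℤ) ℤ.* L₀ ℤ.+ ℤ.- D₀ ℤ.* (c ℤ.* L₁ ℤ.+ L₀ ℤ.- L₀)
  identity₀ = solve-∀
  identity₂ : ∀ c D₀ D₁ L₀ L₁ → c ℤ.* (L₀ ℤ.* D₁ ℤ.- L₁ ℤ.* D₀ ℤ.- (c ℤ.* L₁ ℤ.+ L₀))
    ≡ (c ℤ.* D₁ ℤ.+ D₀) ℤ.* (L₀ ℤ.- (c ℤ.* L₁ ℤ.+ L₀)) ℤ.+ c ℤ.* (D₁ ℤ.- 1ℤ) ℤ.* (c ℤ.* L₁ ℤ.+ L₀)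
  identity₂ = solve-∀
  below-L₀ : L₀ ℤ.≤ c ℤ.* L₁ ℤ.+ L₀ → L₀ ℤ.≤ L₀ ℤ.* D₁ ℤ.- L₁ ℤ.* D₀
  below-L₀ L₀≤L₂ = ≤-by-scaled-difference _ 1≤c (identity₀ c D₀ D₁ L₀ L₁)
    (ℤP.+-mono-≤ (*-nonNeg 0≤c[D₁-1] 0≤L₀) (*-nonNeg (ℤP.neg-mono-≤ D₀≤0) (ℤP.i≤j⇒0≤j-i L₀≤L₂)))
  below-L₂ : c ℤ.* L₁ ℤ.+ L₀ ℤ.≤ L₀ → c ℤ.* L₁ ℤ.+ L₀ ℤ.≤ L₀ ℤ.* D₁ ℤ.- L₁ ℤ.* D₀
  below-L₂ L₂≤L₀ = ≤-by-scaled-difference _ 1≤c (identity₂ c D₀ D₁ L₀ L₁)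
    (ℤP.+-mono-≤ (*-nonNeg (ℤP.≤-trans (+≤+ z≤n) 1≤S) (ℤP.i≤j⇒0≤j-i L₂≤L₀)) (*-nonNeg 0≤c[D₁-1] 0≤L₂))

%-≤-difference : ∀ x y m .{{_ : NonZero m}} → y * m ≤ x → + (x % m) ℤ.≤ + x ℤ.- + y ℤ.* + m
%-≤-difference x y m y*m≤x = ≤-by-difference _ difference
  (*-nonNeg (ℤP.i≤j⇒0≤j-i (+≤+ y≤x/m)) (+≤+ z≤n))
  where
  y≤x/m : y ≤ x / m
  y≤x/m = subst (_≤ x / m) (m*n/n≡m y m) (/-monoˡ-≤ m y*m≤x)
  x≡ : + x ≡ + (x % m) ℤ.+ + (x / m) ℤ.* + m
  x≡ = trans (cong +_ (m≡m%n+[m/n]*n x m))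
         (trans (ℤP.pos-+ (x % m) (x / m * m)) (cong (ℤ._+_ (+ (x % m))) (ℤP.pos-* (x / m) m)))
  identity : ∀ u d y m → u ℤ.+ d ℤ.* m ℤ.- y ℤ.* m ℤ.- u ≡ (d ℤ.- y) ℤ.* m
  identity = solve-∀
  difference : + x ℤ.- + y ℤ.* + m ℤ.- + (x % m) ≡ (+ (x / m) ℤ.- + y) ℤ.* + m
  difference = trans (cong (λ z → z ℤ.- + y ℤ.* + m ℤ.- + (x % m)) x≡)
                     (identity (+ (x % m)) (+ (x / m)) (+ y) (+ m))

minusOnePow : ℕ → ℤ
minusOnePow zero = 1ℤ
minusOnePow (suc zero) = -1ℤ
minusOnePow (suc (suc j)) = minusOnePow j

minusOnePow-suc : ∀ j → minusOnePow (suc j) ≡ ℤ.- minusOnePow j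
minusOnePow-suc zero = refl
minusOnePow-suc (suc zero) = refl
minusOnePow-suc (suc (suc j)) = minusOnePow-suc j

minusOnePow-even : ∀ i → minusOnePow (2 * i) ≡ 1ℤ
minusOnePow-even zero = refl
minusOnePow-even (suc i) rewrite ℕP.*-suc 2 i = minusOnePow-even i

minusOnePow-square : ∀ j → minusOnePow j ℤ.* minusOnePow j ≡ 1ℤ
minusOnePow-square zero = refl
minusOnePow-square (suc zero) = refl
minusOnePow-square (suc (suc j)) = minusOnePow-square j

∣minusOnePow∣ : ∀ j → ℤ.∣ minusOnePow j ∣ ≡ 1
∣minusOnePow∣ zero = refl
∣minusOnePow∣ (suc zero) = refl
∣minusOnePow∣ (suc (suc j)) = ∣minusOnePow∣ j

upcrossing-or-nonPos : (f : ℕ → ℤ) → f 0 ℤ.≤ 0ℤ → ∀ t →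
  (∃ λ i → i < t × f i ℤ.≤ 0ℤ × 1ℤ ℤ.≤ f (suc i)) ⊎ f t ℤ.≤ 0ℤ
upcrossing-or-nonPos f f0≤0 zero = inj₂ f0≤0
upcrossing-or-nonPos f f0≤0 (suc t) with upcrossing-or-nonPos f f0≤0 t
... | inj₁ (i , i<t , crossing) = inj₁ (i , ℕP.m<n⇒m<1+n i<t , crossing)
... | inj₂ ft≤0 with f (suc t) ℤ.≤? 0ℤ
...   | yes fst≤0 = inj₂ fst≤0
...   | no fst≰0 = inj₁ (t , ℕP.n<1+n t , ft≤0 , ℤP.i<j⇒suc[i]≤j (ℤP.≰⇒> fst≰0))

even-or-odd : ∀ n → ∃ λ s → n ≡ 2 * s ⊎ n ≡ 1 + 2 * s
even-or-odd zero = 0 , inj₁ refl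
even-or-odd (suc n) with even-or-odd n
... | s , inj₁ n≡2s = s , inj₂ (cong suc n≡2s)
... | s , inj₂ n≡1+2s = suc s , inj₁ (trans (cong suc n≡1+2s) (sym (ℕP.*-suc 2 s)))

nonNeg-backwards : (F : ℕ → ℤ) (c : ℕ → ℕ) → (∀ j → F j ≡ F (2 + j) ℤ.+ + c j ℤ.* F (1 + j)) →
  ∀ {K} → 0ℤ ℤ.≤ F K → 0ℤ ℤ.≤ F (suc K) → ∀ j → j ≤ K → 0ℤ ℤ.≤ F j × 0ℤ ℤ.≤ F (suc j)
nonNeg-backwards F c rec {K} 0≤FK 0≤FK+1 j j≤K = go (K ℕ.∸ j) j (ℕP.m∸n+n≡m j≤K)
  where
  go : ∀ d j → d + j ≡ K → 0ℤ ℤ.≤ F j × 0ℤ ℤ.≤ F (suc j)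
  go zero j refl = 0≤FK , 0≤FK+1
  go (suc d) j d+j+1≡K with go d (suc j) (trans (ℕP.+-suc d j) d+j+1≡K)
  ... | 0≤Fj+1 , 0≤Fj+2 =
    subst (0ℤ ℤ.≤_) (sym (rec j)) (ℤP.+-mono-≤ 0≤Fj+2 (*-nonNeg {+ c j} (+≤+ z≤n) 0≤Fj+1)) , 0≤Fj+1

module Convergents (a : ℕ → ℕ) where

  P Q : ℕ → ℤ
  P j = + pp a j
  Q j = + qq a j

  P-rec : ∀ j → P (2 + j) ≡ + a j ℤ.* P (1 + j) ℤ.+ P j
  P-rec j = trans (ℤP.pos-+ (a j * pp a (1 + j)) (pp a j)) (cong (ℤ._+ P j) (ℤP.pos-* (a j) (pp a (1 + j))))

  Q-rec : ∀ j → Q (2 + j) ≡ + a j ℤ.* Q (1 + j) ℤ.+ Q j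
  Q-rec j = trans (ℤP.pos-+ (a j * qq a (1 + j)) (qq a j)) (cong (ℤ._+ Q j) (ℤP.pos-* (a j) (qq a (1 + j))))

  det : ∀ j → Q j ℤ.* P (1 + j) ℤ.- P j ℤ.* Q (1 + j) ≡ minusOnePow j
  det zero = refl
  det (suc j) = begin
    Q (1 + j) ℤ.* P (2 + j) ℤ.- P (1 + j) ℤ.* Q (2 + j)
      ≡⟨ cong₂ (λ x y → Q (1 + j) ℤ.* x ℤ.- P (1 + j) ℤ.* y) (P-rec j) (Q-rec j) ⟩
    Q (1 + j) ℤ.* (+ a j ℤ.* P (1 + j) ℤ.+ P j) ℤ.- P (1 + j) ℤ.* (+ a j ℤ.* Q (1 + j) ℤ.+ Q j)
      ≡⟨ identity (Q (1 + j)) (P (1 + j)) (+ a j) (P j) (Q j) ⟩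
    ℤ.- (Q j ℤ.* P (1 + j) ℤ.- P j ℤ.* Q (1 + j))
      ≡⟨ cong ℤ.-_ (det j) ⟩
    ℤ.- minusOnePow j
      ≡⟨ minusOnePow-suc j ⟨
    minusOnePow (1 + j) ∎
    where
    open ≡-Reasoning
    identity : ∀ q₁ p₁ c p₀ q₀ → q₁ ℤ.* (c ℤ.* p₁ ℤ.+ p₀) ℤ.- p₁ ℤ.* (c ℤ.* q₁ ℤ.+ q₀)
                                ≡ ℤ.- (q₀ ℤ.* p₁ ℤ.- p₀ ℤ.* q₁)
    identity = solve-∀

  form : ℤ → ℤ → ℕ → ℤ
  form u w j = Q j ℤ.* u ℤ.- P j ℤ.* w

  form-rec : ∀ u w j → form u w (2 + j) ≡ + a j ℤ.* form u w (1 + j) ℤ.+ form u w j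
  form-rec u w j = begin
    Q (2 + j) ℤ.* u ℤ.- P (2 + j) ℤ.* w
      ≡⟨ cong₂ (λ x y → x ℤ.* u ℤ.- y ℤ.* w) (Q-rec j) (P-rec j) ⟩
    (+ a j ℤ.* Q (1 + j) ℤ.+ Q j) ℤ.* u ℤ.- (+ a j ℤ.* P (1 + j) ℤ.+ P j) ℤ.* w
      ≡⟨ identity (+ a j) (Q (1 + j)) (P (1 + j)) (Q j) (P j) u w ⟩
    + a j ℤ.* form u w (1 + j) ℤ.+ form u w j ∎
    where
    open ≡-Reasoning
    identity : ∀ c q₁ p₁ q₀ p₀ u w → (c ℤ.* q₁ ℤ.+ q₀) ℤ.* u ℤ.- (c ℤ.* p₁ ℤ.+ p₀) ℤ.* w
                                    ≡ c ℤ.* (q₁ ℤ.* u ℤ.- p₁ ℤ.* w) ℤ.+ (q₀ ℤ.* u ℤ.- p₀ ℤ.* w)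
    identity = solve-∀

  form-cross : ∀ u w u′ w′ j → form u w j ℤ.* form u′ w′ (1 + j) ℤ.- form u w (1 + j) ℤ.* form u′ w′ j
                             ≡ minusOnePow j ℤ.* (w ℤ.* u′ ℤ.- u ℤ.* w′)
  form-cross u w u′ w′ j =
    trans (identity (Q j) (P j) (Q (1 + j)) (P (1 + j)) u w u′ w′) (cong (ℤ._* (w ℤ.* u′ ℤ.- u ℤ.* w′)) (det j))
    where
    identity : ∀ q₀ p₀ q₁ p₁ u w u′ w′ →
      (q₀ ℤ.* u ℤ.- p₀ ℤ.* w) ℤ.* (q₁ ℤ.* u′ ℤ.- p₁ ℤ.* w′)
        ℤ.- (q₁ ℤ.* u ℤ.- p₁ ℤ.* w) ℤ.* (q₀ ℤ.* u′ ℤ.- p₀ ℤ.* w′)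
      ≡ (q₀ ℤ.* p₁ ℤ.- p₀ ℤ.* q₁) ℤ.* (w ℤ.* u′ ℤ.- u ℤ.* w′)
    identity = solve-∀

module Denominators (a : ℕ → ℕ) (n : ℕ) (a₀ : a 0 ≡ 0) (a-pos : ∀ i → 1 ≤ i → i ≤ n → 1 ≤ a i) where

  p-zero : p a 0 ≡ 0
  p-zero = cong (λ a₀ → a₀ * 1 + 0) a₀

  q-zero : q a 0 ≡ 1
  q-zero = cong (λ a₀ → a₀ * 0 + 1) a₀

  private
    ≤-scaled : ∀ i x → 1 ≤ i → i ≤ n → x ≤ a i * x
    ≤-scaled i x 1≤i i≤n = ℕP.m≤n*m x (a i) {{ℕ.>-nonZero (a-pos i 1≤i i≤n)}}

  q-≤-step : ∀ k → 1 + k ≤ n → q a k ≤ q a (1 + k)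
  q-≤-step k 1+k≤n = ℕP.≤-trans (≤-scaled (1 + k) (q a k) (s≤s z≤n) 1+k≤n) (ℕP.m≤m+n _ _)

  q-pos : ∀ k → k ≤ n → 1 ≤ q a k
  q-pos zero _ = ℕP.≤-reflexive (sym q-zero)
  q-pos (suc k) 1+k≤n = ℕP.≤-trans (q-pos k (ℕP.<⇒≤ 1+k≤n)) (q-≤-step k 1+k≤n)

  q-<-step : ∀ k → 2 + k ≤ n → q a (1 + k) < q a (2 + k)
  q-<-step k 2+k≤n = begin-strict
    q a (1 + k)                    <⟨ ℕP.m<m+n (q a (1 + k)) (q-pos k (ℕP.≤-trans (ℕP.n≤1+n k) (ℕP.<⇒≤ 2+k≤n))) ⟩
    q a (1 + k) + q a k            ≤⟨ ℕP.+-monoˡ-≤ (q a k) (≤-scaled (2 + k) (q a (1 + k)) (s≤s z≤n) 2+k≤n) ⟩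
    a (2 + k) * q a (1 + k) + q a k ∎
    where open ℕP.≤-Reasoning

  q-mono : ∀ {k l} → k ≤ l → l ≤ n → q a k ≤ q a l
  q-mono {l = zero} z≤n _ = ℕP.≤-refl
  q-mono {k} {suc l} k≤1+l 1+l≤n with ℕP.m≤n⇒m<n∨m≡n k≤1+l
  ... | inj₁ (s≤s k≤l) = ℕP.≤-trans (q-mono k≤l (ℕP.<⇒≤ 1+l≤n)) (q-≤-step l 1+l≤n)
  ... | inj₂ refl = ℕP.≤-refl

  q-<-last : ∀ k → k < n → 2 ≤ q a n → q a k < q a n
  q-<-last zero _ 2≤q = subst (_< q a n) (sym q-zero) 2≤q
  q-<-last (suc k) 1+k<n _ = ℕP.<-≤-trans (q-<-step k 1+k<n) (q-mono 1+k<n ℕP.≤-refl)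

toℚᵘ-/ : ∀ z d → toℚᵘ (z ℚ./ suc d) ≃ mkℚᵘ z d
toℚᵘ-/ z d = ℚP.toℚᵘ-fromℚᵘ (mkℚᵘ z d)

÷-cross-multiply : ∀ {x y d} m → 0 < x → x ÷ suc m ≡ y ÷ d → x * d ≡ y * suc m
÷-cross-multiply {suc x} {d = zero} m _ eq with ℚᵘP.≃-trans (ℚᵘP.≃-sym (toℚᵘ-/ (+ suc x) m)) (ℚP.toℚᵘ-cong eq)
... | *≡* ()
÷-cross-multiply {x} {y} {suc d} m _ eq
  with ℚᵘP.≃-trans (ℚᵘP.≃-sym (toℚᵘ-/ (+ x) m)) (ℚᵘP.≃-trans (ℚP.toℚᵘ-cong eq) (toℚᵘ-/ (+ y) d))
... | *≡* xd≡ym = ℤP.+-injective (trans (ℤP.pos-* x (suc d)) (trans xd≡ym (sym (ℤP.pos-* y (suc m)))))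

-- m divides q_n, and the cofactor divides the determinant q_{n-1} p_n - p_{n-1} q_n = ±1.
convergent-in-lowest-terms : ∀ {r m} a n → 0 < r → gcd r (suc m) ≡ 1 → r ÷ suc m ≡ cfValue a n →
                             p a n ≡ r × q a n ≡ suc m
convergent-in-lowest-terms {r} {m} a n 0<r gcd≡1 value =
  trans p≡rc (trans (cong (r *_) c≡1) (ℕP.*-identityʳ r)) ,
  trans q≡cm (trans (cong (_* suc m) c≡1) (ℕP.*-identityˡ (suc m)))
  where
  open Convergents a
  cross : r * q a n ≡ p a n * suc m
  cross = ÷-cross-multiply m 0<r value
  m∣q : suc m ∣ q a n
  m∣q = coprime-divisor (Coprime.sym (gcd≡1⇒coprime {r} gcd≡1)) (subst (suc m ∣_) (sym cross) (n∣m*n (p a n)))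
  c : ℕ
  c = _∣_.quotient m∣q
  q≡cm : q a n ≡ c * suc m
  q≡cm = _∣_.equality m∣q
  p≡rc : p a n ≡ r * c
  p≡rc = ℕP.*-cancelʳ-≡ (p a n) (r * c) (suc m)
           (trans (sym cross) (trans (cong (r *_) q≡cm) (sym (ℕP.*-assoc r c (suc m)))))
  y : ℤ
  y = Q (1 + n) ℤ.* + r ℤ.- P (1 + n) ℤ.* + suc m
  det≡cy : minusOnePow (1 + n) ≡ + c ℤ.* y
  det≡cy = begin
    minusOnePow (1 + n)                                         ≡⟨ det (1 + n) ⟨
    Q (1 + n) ℤ.* P (2 + n) ℤ.- P (1 + n) ℤ.* Q (2 + n)
      ≡⟨ cong₂ (λ x z → Q (1 + n) ℤ.* x ℤ.- P (1 + n) ℤ.* z)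
               (trans (cong +_ p≡rc) (ℤP.pos-* r c)) (trans (cong +_ q≡cm) (ℤP.pos-* c (suc m))) ⟩
    Q (1 + n) ℤ.* (+ r ℤ.* + c) ℤ.- P (1 + n) ℤ.* (+ c ℤ.* + suc m)
      ≡⟨ identity (Q (1 + n)) (P (1 + n)) (+ r) (+ c) (+ suc m) ⟩
    + c ℤ.* y ∎
    where
    open ≡-Reasoning
    identity : ∀ q₁ p₁ r c m → q₁ ℤ.* (r ℤ.* c) ℤ.- p₁ ℤ.* (c ℤ.* m) ≡ c ℤ.* (q₁ ℤ.* r ℤ.- p₁ ℤ.* m)
    identity = solve-∀
  c≡1 : c ≡ 1
  c≡1 = ∣1⇒≡1 (divides ℤ.∣ y ∣ (trans (sym (∣minusOnePow∣ (1 + n)))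
          (trans (cong ℤ.∣_∣ det≡cy) (trans (ℤP.abs-* (+ c) y) (ℕP.*-comm c ℤ.∣ y ∣)))))

floor-÷ : ∀ x d → floor (x ÷ suc d) ≡ + (x / suc d)
floor-÷ x d = floor-of (x ÷ suc d) refl
  where
  floor-of : ∀ y → y ≡ x ÷ suc d → floor y ≡ + (x / suc d)
  floor-of (mkℚ (+ u) e _) eq with ℚᵘP.≃-trans (ℚP.toℚᵘ-cong eq) (toℚᵘ-/ (+ x) d)
  ... | *≡* ue≡xd = trans (ℤP.*-identityˡ _) (cong +_ (begin
    u / suc e                       ≡⟨ m*n/o*n≡m/o u (suc d) (suc e) ⟨
    (u * suc d) / (suc e * suc d)   ≡⟨ /-congˡ {o = suc e * suc d} u*d≡x*e ⟩
    (x * suc e) / (suc e * suc d)   ≡⟨ /-congʳ {m = x * suc e} (ℕP.*-comm (suc e) (suc d)) ⟩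
    (x * suc e) / (suc d * suc e)   ≡⟨ m*n/o*n≡m/o x (suc e) (suc d) ⟩
    x / suc d                       ∎))
    where
    open ≡-Reasoning
    u*d≡x*e : u * suc d ≡ x * suc e
    u*d≡x*e = ℤP.+-injective (trans (ℤP.pos-* u (suc d)) (trans ue≡xd (sym (ℤP.pos-* x (suc e)))))
  floor-of (mkℚ ℤ.-[1+ _ ] e _) eq with ℚᵘP.≃-trans (ℚP.toℚᵘ-cong eq) (toℚᵘ-/ (+ x) d)
  ... | *≡* neg≡pos with trans neg≡pos (sym (ℤP.pos-* x (suc e)))
  ... | ()

H-summand : ∀ k x d → (k ÷ suc d) ℚ.+ fract (x ÷ suc d) ≡ (+ k ℤ.+ + (x % suc d)) ℚ./ suc d
H-summand k x d = ℚP.toℚᵘ-injective (begin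
    toℚᵘ (k/m ℚ.+ (x/m ℚ.+ ℚ.- ⌊x/m⌋))
      ≈⟨ ℚP.toℚᵘ-homo-+ k/m (x/m ℚ.+ ℚ.- ⌊x/m⌋) ⟩
    toℚᵘ k/m ℚᵘ.+ toℚᵘ (x/m ℚ.+ ℚ.- ⌊x/m⌋)
      ≈⟨ ℚᵘP.+-congʳ (toℚᵘ k/m) (ℚP.toℚᵘ-homo-+ x/m (ℚ.- ⌊x/m⌋)) ⟩
    toℚᵘ k/m ℚᵘ.+ (toℚᵘ x/m ℚᵘ.+ toℚᵘ (ℚ.- ⌊x/m⌋))
      ≈⟨ ℚᵘP.+-congʳ (toℚᵘ k/m) (ℚᵘP.+-congʳ (toℚᵘ x/m) (ℚP.toℚᵘ-homo‿- ⌊x/m⌋)) ⟩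
    toℚᵘ k/m ℚᵘ.+ (toℚᵘ x/m ℚᵘ.+ ℚᵘ.- toℚᵘ ⌊x/m⌋)
      ≈⟨ ℚᵘP.+-cong (toℚᵘ-/ (+ k) d) (ℚᵘP.+-cong (toℚᵘ-/ (+ x) d)
           (ℚᵘP.-‿cong (ℚᵘP.≃-trans (ℚP.toℚᵘ-cong (cong (ℚ._/ 1) (floor-÷ x d))) (toℚᵘ-/ (+ t) 0)))) ⟩
    mkℚᵘ (+ k) d ℚᵘ.+ (mkℚᵘ (+ x) d ℚᵘ.+ ℚᵘ.- mkℚᵘ (+ t) 0)
      ≈⟨ *≡* (trans (cong (λ x → (+ k ℤ.* (+ suc d ℤ.* 1ℤ) ℤ.+ (x ℤ.* 1ℤ ℤ.+ ℤ.- + t ℤ.* + suc d) ℤ.* + suc d)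
                                   ℤ.* + suc d) x≡)
                    (identity (+ k) (+ t) (+ u) (+ suc d))) ⟩
    mkℚᵘ (+ k ℤ.+ + u) d
      ≈⟨ toℚᵘ-/ (+ k ℤ.+ + u) d ⟨
    toℚᵘ ((+ k ℤ.+ + u) ℚ./ suc d) ∎)
  where
  open ℚᵘP.≃-Reasoning
  k/m x/m ⌊x/m⌋ : ℚ
  k/m = k ÷ suc d
  x/m = x ÷ suc d
  ⌊x/m⌋ = floor x/m ℚ./ 1
  t u : ℕ
  t = x / suc d
  u = x % suc d
  x≡ : + x ≡ + u ℤ.+ + t ℤ.* + suc d
  x≡ = trans (cong +_ (m≡m%n+[m/n]*n x (suc d)))
         (trans (ℤP.pos-+ u (t * suc d)) (cong (ℤ._+_ (+ u)) (ℤP.pos-* t (suc d))))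
  identity : ∀ k t u m → (k ℤ.* (m ℤ.* 1ℤ) ℤ.+ ((u ℤ.+ t ℤ.* m) ℤ.* 1ℤ ℤ.+ ℤ.- t ℤ.* m) ℤ.* m) ℤ.* m
                         ≡ (k ℤ.+ u) ℤ.* (m ℤ.* (m ℤ.* 1ℤ))
  identity = solve-∀

convergent-summand : ∀ x y u d → ⟦ x ⟧ *ℚ (u ÷ suc d) - ⟦ y ⟧ ≡ (+ x ℤ.* + u ℤ.- + y ℤ.* + suc d) ℚ./ suc d
convergent-summand x y u d = ℚP.toℚᵘ-injective (begin
    toℚᵘ (⟦ x ⟧ *ℚ (u ÷ suc d) ℚ.+ ℚ.- ⟦ y ⟧)
      ≈⟨ ℚP.toℚᵘ-homo-+ (⟦ x ⟧ *ℚ (u ÷ suc d)) (ℚ.- ⟦ y ⟧) ⟩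
    toℚᵘ (⟦ x ⟧ *ℚ (u ÷ suc d)) ℚᵘ.+ toℚᵘ (ℚ.- ⟦ y ⟧)
      ≈⟨ ℚᵘP.+-cong (ℚP.toℚᵘ-homo-* ⟦ x ⟧ (u ÷ suc d)) (ℚP.toℚᵘ-homo‿- ⟦ y ⟧) ⟩
    toℚᵘ ⟦ x ⟧ ℚᵘ.* toℚᵘ (u ÷ suc d) ℚᵘ.+ ℚᵘ.- toℚᵘ ⟦ y ⟧
      ≈⟨ ℚᵘP.+-cong (ℚᵘP.*-cong (toℚᵘ-/ (+ x) 0) (toℚᵘ-/ (+ u) d)) (ℚᵘP.-‿cong (toℚᵘ-/ (+ y) 0)) ⟩
    mkℚᵘ (+ x) 0 ℚᵘ.* mkℚᵘ (+ u) d ℚᵘ.+ ℚᵘ.- mkℚᵘ (+ y) 0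
      ≈⟨ *≡* (identity (+ x) (+ u) (+ y) (+ suc d)) ⟩
    mkℚᵘ (+ x ℤ.* + u ℤ.- + y ℤ.* + suc d) d
      ≈⟨ toℚᵘ-/ _ d ⟨
    toℚᵘ ((+ x ℤ.* + u ℤ.- + y ℤ.* + suc d) ℚ./ suc d) ∎)
  where
  open ℚᵘP.≃-Reasoning
  identity : ∀ x u y m → (x ℤ.* u ℤ.* 1ℤ ℤ.+ ℤ.- y ℤ.* (1ℤ ℤ.* m)) ℤ.* m
                        ≡ (x ℤ.* u ℤ.- y ℤ.* m) ℤ.* ((1ℤ ℤ.* m) ℤ.* 1ℤ)
  identity = solve-∀

/-monoˡ-≤-ℚ : ∀ {x y} d → x ℤ.≤ y → x ℚ./ suc d ℚ.≤ y ℚ./ suc d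
/-monoˡ-≤-ℚ {x} {y} d x≤y = ℚP.toℚᵘ-cancel-≤
  (ℚᵘP.≤-respʳ-≃ (ℚᵘP.≃-sym (toℚᵘ-/ y d)) (ℚᵘP.≤-respˡ-≃ (ℚᵘP.≃-sym (toℚᵘ-/ x d))
    (*≤* (ℤP.*-monoʳ-≤-nonNeg (+ suc d) x≤y))))

minOver-≤ : ∀ (f : ℕ → ℚ) {xs y} → y ∈ xs → minOver f xs ℚ.≤ f y
minOver-≤ f {x ∷ []} (here refl) = ℚP.≤-refl
minOver-≤ f {x ∷ z ∷ zs} (here refl) = ℚP.≤-trans (ℚP.p⊓q≤q (f z) _) (minOver-≤ f {x ∷ zs} (here refl))
minOver-≤ f {x ∷ z ∷ zs} (there (here refl)) = ℚP.p⊓q≤p (f z) _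
minOver-≤ f {x ∷ z ∷ zs} (there (there y∈zs)) = ℚP.≤-trans (ℚP.p⊓q≤q (f z) _) (minOver-≤ f {x ∷ zs} (there y∈zs))

minOver-attained : ∀ (f : ℕ → ℚ) {xs x₀} → x₀ ∈ xs → ∃ λ x → x ∈ xs × minOver f xs ≡ f x
minOver-attained f {x ∷ xs} _ = attained x xs
  where
  attained : ∀ x xs → ∃ λ y → y ∈ x ∷ xs × minOver f (x ∷ xs) ≡ f y
  attained x [] = x , here refl , refl
  attained x (z ∷ zs) with ℚP.⊓-sel (f z) (minOver f (x ∷ zs)) | attained x zs
  ... | inj₁ min≡fz | _ = z , there (here refl) , min≡fz
  ... | inj₂ min≡rest | y , here refl , eq = y , here refl , trans min≡rest eq
  ... | inj₂ min≡rest | y , there y∈zs , eq = y , there (there y∈zs) , trans min≡rest eq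

minOver-≡ : ∀ (f g : ℕ → ℚ) {xs ys x₀} → x₀ ∈ xs →
  (∀ {x} → x ∈ xs → ∃ λ y → y ∈ ys × g y ℚ.≤ f x) →
  (∀ {y} → y ∈ ys → ∃ λ x → x ∈ xs × f x ℚ.≤ g y) →
  minOver f xs ≡ minOver g ys
minOver-≡ f g x₀∈xs below-f below-g
  with minOver-attained f x₀∈xs
... | x , x∈xs , minf≡fx with below-f x∈xs
...   | y , y∈ys , gy≤fx with minOver-attained g y∈ys
...     | y′ , y′∈ys , ming≡gy′ with below-g y′∈ys
...       | x′ , x′∈xs , fx′≤gy′ = ℚP.≤-antisym
  (ℚP.≤-trans (minOver-≤ f x′∈xs) (subst (f x′ ℚ.≤_) (sym ming≡gy′) fx′≤gy′))
  (ℚP.≤-trans (minOver-≤ g y∈ys) (subst (g y ℚ.≤_) (sym minf≡fx) gy≤fx))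

∈-suc-upTo⁺ : ∀ {m k} → 1 ≤ k → k < suc m → k ∈ map suc (upTo m)
∈-suc-upTo⁺ {k = suc k} _ (s≤s k<m) = ∈-map⁺ suc (∈-upTo⁺ k<m)

∈-suc-upTo⁻ : ∀ {m k} → k ∈ map suc (upTo m) → 1 ≤ k × k < suc m
∈-suc-upTo⁻ k∈ with ∈-map⁻ suc k∈
... | _ , j∈ , refl = s≤s z≤n , s≤s (∈-upTo⁻ j∈)

∈-evenRange⁺ : ∀ {n i} → 2 * i < n → i ∈ evenRange n
∈-evenRange⁺ {n} {i} 2i<n = ∈-filter⁺ (λ k → Dec.T? ((2 * k) ℕ.<ᵇ n))
  (∈-upTo⁺ (ℕP.≤-<-trans (ℕP.m≤n*m i 2) 2i<n)) (ℕP.<⇒<ᵇ 2i<n)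

∈-evenRange⁻ : ∀ {n i} → i ∈ evenRange n → 2 * i < n
∈-evenRange⁻ {n} {i} i∈ = ℕP.<ᵇ⇒< (2 * i) n (proj₂ (∈-filter⁻ (λ k → Dec.T? ((2 * k) ℕ.<ᵇ n)) {xs = upTo n} i∈))

module Expansion (a : ℕ → ℕ) (n r m : ℕ) .{{_ : NonZero m}} (1≤n : 1 ≤ n) (a₀ : a 0 ≡ 0)
  (a-pos : ∀ i → 1 ≤ i → i ≤ n → 1 ≤ a i) (0<r : 0 < r) (r<m : r < m) (coprime : Coprime r m)
  (p-last : p a n ≡ r) (q-last : q a n ≡ m) where

  open Convergents a
  open Denominators a n a₀ a-pos

  -- E (2 + k) = q_k r - p_k m and L (2 + k) = q_k (r + 1) - p_k m; the theorem minimises L (2 + 2 i) / m.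
  E L : ℕ → ℤ
  E = form (+ r) (+ m)
  L = form (+ (r + 1)) (+ m)

  L≡Q+E : ∀ j → L j ≡ Q j ℤ.+ E j
  L≡Q+E j = trans (cong (λ u → Q j ℤ.* u ℤ.- P j ℤ.* + m) (ℤP.pos-+ r 1)) (identity (Q j) (P j) (+ r) (+ m))
    where
    identity : ∀ q p r m → q ℤ.* (r ℤ.+ 1ℤ) ℤ.- p ℤ.* m ≡ q ℤ.+ (q ℤ.* r ℤ.- p ℤ.* m)
    identity = solve-∀

  E-last : E (2 + n) ≡ 0ℤ
  E-last = trans (cong₂ (λ x y → x ℤ.* + r ℤ.- y ℤ.* + m) (cong +_ q-last) (cong +_ p-last)) (identity (+ m) (+ r))
    where
    identity : ∀ m r → m ℤ.* r ℤ.- r ℤ.* m ≡ 0ℤ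
    identity = solve-∀

  E-penultimate : E (1 + n) ≡ minusOnePow (1 + n)
  E-penultimate = trans (cong₂ (λ x y → Q (1 + n) ℤ.* x ℤ.- P (1 + n) ℤ.* y)
                               (cong +_ (sym p-last)) (cong +_ (sym q-last)))
                        (det (1 + n))

  -- (-1)^j E j satisfies the recurrence read backwards, with nonnegative coefficients,
  -- and equals 1 at j = n + 1 and 0 at j = n + 2.
  E-even-nonNeg : ∀ i → 2 * i ≤ n → 0ℤ ℤ.≤ E (2 + 2 * i)
  E-even-nonNeg i 2i≤n =
    subst (0ℤ ℤ.≤_) (trans (cong (ℤ._* E (2 + 2 * i)) (minusOnePow-even i)) (ℤP.*-identityˡ _))
    (proj₂ (nonNeg-backwards F a F-rec 0≤F[1+n] 0≤F[2+n] (1 + 2 * i) (s≤s 2i≤n)))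
    where
    F : ℕ → ℤ
    F j = minusOnePow j ℤ.* E j
    identity : ∀ s c e₁ e₀ → s ℤ.* e₀ ≡ s ℤ.* (c ℤ.* e₁ ℤ.+ e₀) ℤ.+ c ℤ.* (ℤ.- s ℤ.* e₁)
    identity = solve-∀
    F-rec : ∀ j → F j ≡ F (2 + j) ℤ.+ + a j ℤ.* F (1 + j)
    F-rec j = trans (identity (minusOnePow j) (+ a j) (E (1 + j)) (E j))
      (cong₂ (λ x y → minusOnePow j ℤ.* x ℤ.+ + a j ℤ.* (y ℤ.* E (1 + j)))
             (sym (form-rec (+ r) (+ m) j)) (sym (minusOnePow-suc j)))
    0≤F[1+n] : 0ℤ ℤ.≤ F (1 + n)
    0≤F[1+n] = subst (0ℤ ℤ.≤_)
      (sym (trans (cong (minusOnePow (1 + n) ℤ.*_) E-penultimate) (minusOnePow-square (1 + n)))) (+≤+ z≤n)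
    0≤F[2+n] : 0ℤ ℤ.≤ F (2 + n)
    0≤F[2+n] = subst (0ℤ ℤ.≤_)
      (sym (trans (cong (minusOnePow (2 + n) ℤ.*_) E-last) (ℤP.*-zeroʳ (minusOnePow (2 + n))))) (+≤+ z≤n)

  L-even-nonNeg : ∀ i → 2 * i ≤ n → 0ℤ ℤ.≤ L (2 + 2 * i)
  L-even-nonNeg i 2i≤n = subst (0ℤ ℤ.≤_) (sym (L≡Q+E (2 + 2 * i))) (ℤP.+-mono-≤ (+≤+ z≤n) (E-even-nonNeg i 2i≤n))

  L-last : L (2 + n) ≡ + m
  L-last = trans (L≡Q+E (2 + n)) (trans (cong₂ ℤ._+_ (cong +_ q-last) E-last) (ℤP.+-identityʳ (+ m)))

  L-first≤L-last : L 2 ℤ.≤ L (2 + n)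
  L-first≤L-last = subst₂ ℤ._≤_ (sym L-first) (sym L-last) (+≤+ (subst (_≤ m) (ℕP.+-comm 1 r) r<m))
    where
    identity : ∀ u m → 1ℤ ℤ.* u ℤ.- 0ℤ ℤ.* m ≡ u
    identity = solve-∀
    L-first : L 2 ≡ + (r + 1)
    L-first = trans (cong₂ (λ x y → x ℤ.* + (r + 1) ℤ.- y ℤ.* + m) (cong +_ q-zero) (cong +_ p-zero))
                    (identity (+ (r + 1)) (+ m))

  L-even-bound : ∀ {x} i → 2 * i ≤ n → L (2 + 2 * i) ℤ.≤ x → ∃ λ i′ → 2 * i′ < n × L (2 + 2 * i′) ℤ.≤ x
  L-even-bound i 2i≤n Lᵢ≤x with ℕP.m≤n⇒m<n∨m≡n 2i≤n
  ... | inj₁ 2i<n = i , 2i<n , Lᵢ≤x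
  ... | inj₂ 2i≡n = 0 , 1≤n , ℤP.≤-trans L-first≤L-last (subst (λ j → L (2 + j) ℤ.≤ _) 2i≡n Lᵢ≤x)

  even-convergent-H-term : ∀ i → 2 * i < n → let k = q a (2 * i) in
    1 ≤ k × k < m × + k ℤ.+ + (k * r % m) ℤ.≤ L (2 + 2 * i)
  even-convergent-H-term i 2i<n =
    q-pos (2 * i) (ℕP.<⇒≤ 2i<n) ,
    subst (q a (2 * i) <_) q-last (q-<-last (2 * i) 2i<n (subst (2 ≤_) (sym q-last) (ℕP.≤-trans (s≤s 0<r) r<m))) ,
    subst (+ k ℤ.+ + (k * r % m) ℤ.≤_) (sym (L≡Q+E (2 + 2 * i))) (ℤP.+-monoʳ-≤ (+ k) remainder≤E)
    where
    k l : ℕ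
    k = q a (2 * i)
    l = p a (2 * i)
    0≤E : 0ℤ ℤ.≤ + k ℤ.* + r ℤ.- + l ℤ.* + m
    0≤E = E-even-nonNeg i (ℕP.<⇒≤ 2i<n)
    l*m≤k*r : l * m ≤ k * r
    l*m≤k*r = ℤP.drop‿+≤+ (subst₂ ℤ._≤_ (sym (ℤP.pos-* l m)) (sym (ℤP.pos-* k r)) (ℤP.0≤i-j⇒j≤i 0≤E))
    remainder≤E : + (k * r % m) ℤ.≤ E (2 + 2 * i)
    remainder≤E = subst (λ z → + (k * r % m) ℤ.≤ z ℤ.- + l ℤ.* + m) (ℤP.pos-* k r)
                        (%-≤-difference (k * r) l m l*m≤k*r)

  -- By Cramer's rule, ± (D (j + 1), - D j) are the coordinates of (k, ⌊k r / m⌋) in the basis of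
  -- the consecutive convergents (Q j, P j), (Q (j + 1), P (j + 1)); they turn from D ≤ 0 at j = 2
  -- to D = k r mod m > 0 at j = n + 2.
  module LatticePoint (k : ℕ) (1≤k : 1 ≤ k) (k<m : k < m) where

    t e : ℕ
    t = k * r / m
    e = k * r % m

    D : ℕ → ℤ
    D = form (ℤ.- + t) (ℤ.- + k)

    e≡ : + e ≡ + k ℤ.* + r ℤ.- + t ℤ.* + m
    e≡ = sym (trans (cong (ℤ._- + t ℤ.* + m) kr≡) (identity (+ e) (+ t ℤ.* + m)))
      where
      kr≡ : + k ℤ.* + r ≡ + e ℤ.+ + t ℤ.* + m
      kr≡ = trans (sym (ℤP.pos-* k r)) (trans (cong +_ (m≡m%n+[m/n]*n (k * r) m))
              (trans (ℤP.pos-+ e (t * m)) (cong (ℤ._+_ (+ e)) (ℤP.pos-* t m))))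
      identity : ∀ e x → e ℤ.+ x ℤ.- x ≡ e
      identity = solve-∀

    1≤e : 1 ≤ e
    1≤e = ℕP.n≢0⇒n>0 λ e≡0 → ℕP.<⇒≱ k<m (∣⇒≤ {{ℕ.>-nonZero 1≤k}}
            (coprime-divisor (Coprime.sym coprime) (subst (m ∣_) (ℕP.*-comm k r) (m%n≡0⇒n∣m (k * r) m e≡0))))

    D-first : D 2 ℤ.≤ 0ℤ
    D-first = subst (ℤ._≤ 0ℤ) (sym D₂≡) (ℤP.neg-≤-pos {t} {0})
      where
      identity : ∀ t k → 1ℤ ℤ.* ℤ.- t ℤ.- 0ℤ ℤ.* ℤ.- k ≡ ℤ.- t
      identity = solve-∀
      D₂≡ : D 2 ≡ ℤ.- + t
      D₂≡ = trans (cong₂ (λ x y → x ℤ.* ℤ.- + t ℤ.- y ℤ.* ℤ.- + k) (cong +_ q-zero) (cong +_ p-zero))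
                  (identity (+ t) (+ k))

    D-last : D (2 + n) ≡ + e
    D-last = trans (cong₂ (λ x y → x ℤ.* ℤ.- + t ℤ.- y ℤ.* ℤ.- + k) (cong +_ q-last) (cong +_ p-last))
                   (trans (identity (+ m) (+ t) (+ r) (+ k)) (sym e≡))
      where
      identity : ∀ m t r k → m ℤ.* ℤ.- t ℤ.- r ℤ.* ℤ.- k ≡ k ℤ.* r ℤ.- t ℤ.* m
      identity = solve-∀

    X≡cross : ∀ i → + k ℤ.+ + e ≡ L (2 + 2 * i) ℤ.* D (3 + 2 * i) ℤ.- L (3 + 2 * i) ℤ.* D (2 + 2 * i)
    X≡cross i = begin
      + k ℤ.+ + e
        ≡⟨ cong (ℤ._+_ (+ k)) e≡ ⟩
      + k ℤ.+ (+ k ℤ.* + r ℤ.- + t ℤ.* + m)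
        ≡⟨ identity (+ k) (+ r) (+ t) (+ m) ⟩
      + m ℤ.* ℤ.- + t ℤ.- (+ r ℤ.+ 1ℤ) ℤ.* ℤ.- + k
        ≡⟨ cong (λ u → + m ℤ.* ℤ.- + t ℤ.- u ℤ.* ℤ.- + k) (ℤP.pos-+ r 1) ⟨
      + m ℤ.* ℤ.- + t ℤ.- + (r + 1) ℤ.* ℤ.- + k
        ≡⟨ ℤP.*-identityˡ _ ⟨
      1ℤ ℤ.* (+ m ℤ.* ℤ.- + t ℤ.- + (r + 1) ℤ.* ℤ.- + k)
        ≡⟨ cong (ℤ._* _) (minusOnePow-even i) ⟨
      minusOnePow (2 * i) ℤ.* (+ m ℤ.* ℤ.- + t ℤ.- + (r + 1) ℤ.* ℤ.- + k)
        ≡⟨ form-cross (+ (r + 1)) (+ m) (ℤ.- + t) (ℤ.- + k) (2 + 2 * i) ⟨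
      L (2 + 2 * i) ℤ.* D (3 + 2 * i) ℤ.- L (3 + 2 * i) ℤ.* D (2 + 2 * i) ∎
      where
      open ≡-Reasoning
      identity : ∀ k r t m → k ℤ.+ (k ℤ.* r ℤ.- t ℤ.* m) ≡ m ℤ.* ℤ.- t ℤ.- (r ℤ.+ 1ℤ) ℤ.* ℤ.- k
      identity = solve-∀

    upcrossing-bound : ∀ {s} i → i < s → 2 * s ≤ n → D (2 + 2 * i) ℤ.≤ 0ℤ → 1ℤ ℤ.≤ D (2 + 2 * suc i) →
                       ∃ λ i′ → 2 * i′ < n × L (2 + 2 * i′) ℤ.≤ + k ℤ.+ + e
    upcrossing-bound i i<s 2s≤n Dᵢ≤0 1≤Dᵢ₊₁ = Sum.[ bound-at-i , bound-at-1+i ]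
      (min-≤-cross-difference {+ a (2 + 2 * i)} (+≤+ (a-pos (2 + 2 * i) (s≤s z≤n) 2+2i≤n)) Dᵢ≤0
        (subst (1ℤ ℤ.≤_) (form-rec _ _ (2 + 2 * i)) (subst (λ j → 1ℤ ℤ.≤ D (2 + j)) (ℕP.*-suc 2 i) 1≤Dᵢ₊₁))
        (L-even-nonNeg i (ℕP.<⇒≤ 2i<n))
        (subst (0ℤ ℤ.≤_) (form-rec _ _ (2 + 2 * i)) (subst (λ j → 0ℤ ℤ.≤ L (2 + j)) (ℕP.*-suc 2 i) 0≤Lᵢ₊₁)))
      where
      2[1+i]≤n : 2 * suc i ≤ n
      2[1+i]≤n = ℕP.≤-trans (ℕP.*-monoʳ-≤ 2 i<s) 2s≤n
      2+2i≤n : 2 + 2 * i ≤ n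
      2+2i≤n = subst (_≤ n) (ℕP.*-suc 2 i) 2[1+i]≤n
      2i<n : 2 * i < n
      2i<n = ℕP.<-≤-trans (ℕP.m<n+m (2 * i) {2} (s≤s z≤n)) 2+2i≤n
      0≤Lᵢ₊₁ : 0ℤ ℤ.≤ L (2 + 2 * suc i)
      0≤Lᵢ₊₁ = L-even-nonNeg (suc i) 2[1+i]≤n
      bound-at-i : L (2 + 2 * i) ℤ.≤ _ → ∃ λ i′ → 2 * i′ < n × L (2 + 2 * i′) ℤ.≤ + k ℤ.+ + e
      bound-at-i Lᵢ≤X = i , 2i<n , subst (L (2 + 2 * i) ℤ.≤_) (sym (X≡cross i)) Lᵢ≤X
      bound-at-1+i : + a (2 + 2 * i) ℤ.* L (3 + 2 * i) ℤ.+ L (2 + 2 * i) ℤ.≤ _ →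
                     ∃ λ i′ → 2 * i′ < n × L (2 + 2 * i′) ℤ.≤ + k ℤ.+ + e
      bound-at-1+i Lᵢ₊₁≤X = L-even-bound (suc i) 2[1+i]≤n
        (subst₂ ℤ._≤_ (trans (sym (form-rec _ _ (2 + 2 * i))) (cong (λ j → L (2 + j)) (sym (ℕP.*-suc 2 i))))
                      (sym (X≡cross i)) Lᵢ₊₁≤X)

    nonPos-bound : ∀ s → n ≡ 2 * s ⊎ n ≡ 1 + 2 * s → D (2 + 2 * s) ℤ.≤ 0ℤ →
                   ∃ λ i → 2 * i < n × L (2 + 2 * i) ℤ.≤ + k ℤ.+ + e
    nonPos-bound s (inj₁ n≡2s) Dₛ≤0 = ⊥-elim (1ℤ≰0ℤ (ℤP.≤-trans 1≤Dₛ Dₛ≤0))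
      where
      1≤Dₛ : 1ℤ ℤ.≤ D (2 + 2 * s)
      1≤Dₛ = subst (1ℤ ℤ.≤_) (trans (sym D-last) (cong (λ j → D (2 + j)) n≡2s)) (+≤+ 1≤e)
      1ℤ≰0ℤ : 1ℤ ℤ.≤ 0ℤ → ⊥
      1ℤ≰0ℤ (+≤+ ())
    nonPos-bound s (inj₂ n≡1+2s) Dₛ≤0 = s , 2s<n , subst (L (2 + 2 * s) ℤ.≤_) (sym (X≡cross s))
      (≤-cross-difference Dₛ≤0 1≤D[3+2s] (L-even-nonNeg s (ℕP.<⇒≤ 2s<n)) 0≤L[3+2s])
      where
      2s<n : 2 * s < n
      2s<n = ℕP.≤-reflexive (sym n≡1+2s)
      1≤D[3+2s] : 1ℤ ℤ.≤ D (3 + 2 * s)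
      1≤D[3+2s] = subst (1ℤ ℤ.≤_) (trans (sym D-last) (cong (λ j → D (2 + j)) n≡1+2s)) (+≤+ 1≤e)
      0≤L[3+2s] : 0ℤ ℤ.≤ L (3 + 2 * s)
      0≤L[3+2s] = subst (0ℤ ℤ.≤_) (trans (sym L-last) (cong (λ j → L (2 + j)) n≡1+2s)) (+≤+ z≤n)

    bound : ∃ λ i → 2 * i < n × L (2 + 2 * i) ℤ.≤ + k ℤ.+ + e
    bound with even-or-odd n
    ... | s , parity with upcrossing-or-nonPos (λ i → D (2 + 2 * i)) D-first s
    ...   | inj₁ (i , i<s , Dᵢ≤0 , 1≤Dᵢ₊₁) = upcrossing-bound i i<s 2s≤n Dᵢ≤0 1≤Dᵢ₊₁
      where
      2s≤n : 2 * s ≤ n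
      2s≤n = Sum.[ ℕP.≤-reflexive ∘ sym , (λ n≡1+2s → ℕP.≤-trans (ℕP.n≤1+n _) (ℕP.≤-reflexive (sym n≡1+2s))) ]
                   parity
    ...   | inj₂ Dₛ≤0 = nonPos-bound s parity Dₛ≤0

theorem2p5 : (r m n : ℕ) (a : ℕ → ℕ) →
    0 < r → r < m → gcd r m ≡ 1 →
    1 ≤ n → a 0 ≡ 0 → (∀ i → 1 ≤ i → i ≤ n → 1 ≤ a i) →
    r ÷ m ≡ cfValue a n →
    H r m ≡ minOver (λ k → (⟦ q a (2 * k) ⟧ *ℚ ((r + 1) ÷ m)) - ⟦ p a (2 * k) ⟧) (evenRange n)
theorem2p5 r zero n a _ () _ _ _ _ _
theorem2p5 r (suc m) n a 0<r r<m gcd≡1 1≤n a₀ a-pos value =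
  minOver-≡ f g (∈-suc-upTo⁺ (s≤s z≤n) (ℕP.≤-trans (s≤s 0<r) r<m)) H-side convergent-side
  where
  lowest : p a n ≡ r × q a n ≡ suc m
  lowest = convergent-in-lowest-terms a n 0<r gcd≡1 value
  open Expansion a n r (suc m) 1≤n a₀ a-pos 0<r r<m (gcd≡1⇒coprime gcd≡1) (proj₁ lowest) (proj₂ lowest)
  f g : ℕ → ℚ
  f k = (k ÷ suc m) ℚ.+ fract ((k * r) ÷ suc m)
  g i = (⟦ q a (2 * i) ⟧ *ℚ ((r + 1) ÷ suc m)) - ⟦ p a (2 * i) ⟧
  f≡ : ∀ k → f k ≡ (+ k ℤ.+ + (k * r % suc m)) ℚ./ suc m
  f≡ k = H-summand k (k * r) m
  g≡ : ∀ i → g i ≡ L (2 + 2 * i) ℚ./ suc m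
  g≡ i = convergent-summand (q a (2 * i)) (p a (2 * i)) (r + 1) m
  H-side : ∀ {k} → k ∈ map suc (upTo m) → ∃ λ i → i ∈ evenRange n × g i ℚ.≤ f k
  H-side {k} k∈ = below (LatticePoint.bound k (proj₁ (∈-suc-upTo⁻ k∈)) (proj₂ (∈-suc-upTo⁻ k∈)))
    where
    below : (∃ λ i → 2 * i < n × L (2 + 2 * i) ℤ.≤ + k ℤ.+ + (k * r % suc m)) →
            ∃ λ i → i ∈ evenRange n × g i ℚ.≤ f k
    below (i , 2i<n , Lᵢ≤X) =
      i , ∈-evenRange⁺ 2i<n , subst₂ ℚ._≤_ (sym (g≡ i)) (sym (f≡ k)) (/-monoˡ-≤-ℚ m Lᵢ≤X)
  convergent-side : ∀ {i} → i ∈ evenRange n → ∃ λ k → k ∈ map suc (upTo m) × f k ℚ.≤ g i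
  convergent-side {i} i∈ = above (even-convergent-H-term i (∈-evenRange⁻ i∈))
    where
    k : ℕ
    k = q a (2 * i)
    above : 1 ≤ k × k < suc m × + k ℤ.+ + (k * r % suc m) ℤ.≤ L (2 + 2 * i) →
            ∃ λ k → k ∈ map suc (upTo m) × f k ℚ.≤ g i
    above (1≤k , k<m , X≤Lᵢ) =
      k , ∈-suc-upTo⁺ 1≤k k<m , subst₂ ℚ._≤_ (sym (f≡ k)) (sym (g≡ i)) (/-monoˡ-≤-ℚ m X≤Lᵢ)
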